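{- Let $j\ge0$ be an integer and for $n\ge0$ let $K_n=|\mathrm{SSYT}((3n-j,j),(n,n,n))|$ (taken to be $0$ when $3n-j<j$). Then $K_n=0$ for $n<\lceil 2j/3\rceil$ and $K_n>0$ for $n=\lceil 2j/3\rceil$; $K_n$ strictly increases for $\lceil 2j/3\rceil\le n\le j$ and $K_n=j+1$ for all $n\ge j$; and at $n_0=\lceil 2j/3\rceil$ one has $K_{n_0}=1,2,3$ according as $j\equiv 0,1,2\pmod 3$. Moreover, among the tableaux in $\mathrm{SSYT}((3n_0-j,j),(n_0,n_0,n_0))$, the one with the fewest entries $2$ in its second row has exactly $\lfloor j/3\rfloor$ entries $2$ and $\lceil 2j/3\rceil$ entries $3$ in its second row.
   Context: $\mathrm{SSYT}(\mu,(n,n,n))$ is the set of semistandard tableaux (rows weakly increasing, columns strictly increasing) of shape $\mu$ in which each of $1,2,3$ occurs $n$ times; for $n=0$ it consists of the empty tableau of empty shape. -}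

module Defs where

open import Data.Nat using (ℕ; zero; suc; _+_; _*_; _∸_; _≤_; _<_; _≤?_; _<?_)
open import Data.Nat.Properties using (_≟_)
open import Data.Nat.DivMod using (_/_)
open import Data.Fin using (Fin; inject≤)
import Data.Fin as F
import Data.Fin.Properties as FP
open import Data.Vec using (Vec; []; _∷_; lookup; count)
open import Data.List using (List; []; _∷_; map; concatMap; filter; cartesianProduct; length)
open import Data.Product using (_×_; _,_; proj₁; proj₂)
open import Relation.Nullary using (Dec; yes; no)
open import Relation.Nullary.Decidable using (_×-dec_; _→-dec_)
open import Relation.Binary.PropositionalEquality using (_≡_)

Filling : ℕ → ℕ → Set
Filling a b = Vec ℕ a × Vec ℕ b

WeaklyIncreasing : ∀ {m} → Vec ℕ m → Set
WeaklyIncreasing {m} v = (i k : Fin m) → i F.≤ k → lookup v i ≤ lookup v k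

ColumnStrict : ∀ {a b} → b ≤ a → Filling a b → Set
ColumnStrict {a} {b} b≤a (r₁ , r₂) = (i : Fin b) → lookup r₁ (inject≤ i b≤a) < lookup r₂ i

occ : ∀ {m} → ℕ → Vec ℕ m → ℕ
occ v = count (_≟ v)

occT : ∀ {a b} → ℕ → Filling a b → ℕ
occT v (r₁ , r₂) = occ v r₁ + occ v r₂

HasContent : ∀ {a b} → ℕ → Filling a b → Set
HasContent n T = (occT 1 T ≡ n) × (occT 2 T ≡ n) × (occT 3 T ≡ n)

-- T ∈ SSYT((a , b), (n , n , n)).  (Entries are positive integers;
-- positivity / membership in {1,2,3} follows from the content when
-- a + b = 3n, and is also imposed explicitly.)
EntriesIn123 : ∀ {a b} → Filling a b → Set
EntriesIn123 {a} {b} (r₁ , r₂) =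
  ((i : Fin a) → (1 ≤ lookup r₁ i) × (lookup r₁ i ≤ 3)) ×
  ((i : Fin b) → (1 ≤ lookup r₂ i) × (lookup r₂ i ≤ 3))

IsSSYT : ∀ {a b} → b ≤ a → ℕ → Filling a b → Set
IsSSYT b≤a n T =
  EntriesIn123 T × WeaklyIncreasing (proj₁ T) × WeaklyIncreasing (proj₂ T)
  × ColumnStrict b≤a T × HasContent n T

private
  bnd? : (x : ℕ) → Dec ((1 ≤ x) × (x ≤ 3))
  bnd? x = (1 ≤? x) ×-dec (x ≤? 3)

  wi? : ∀ {m} (v : Vec ℕ m) → Dec (WeaklyIncreasing v)
  wi? v = FP.all? λ i → FP.all? λ k → (i FP.≤? k) →-dec (lookup v i ≤? lookup v k)

isSSYT? : ∀ {a b} (b≤a : b ≤ a) (n : ℕ) (T : Filling a b) → Dec (IsSSYT b≤a n T)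
isSSYT? b≤a n (r₁ , r₂) =
  ((FP.all? λ i → bnd? (lookup r₁ i)) ×-dec (FP.all? λ i → bnd? (lookup r₂ i)))
  ×-dec wi? r₁ ×-dec wi? r₂
  ×-dec (FP.all? λ i → _ <? _)
  ×-dec ((occT 1 (r₁ , r₂) ≟ n) ×-dec (occT 2 (r₁ , r₂) ≟ n) ×-dec (occT 3 (r₁ , r₂) ≟ n))

allVec : (m : ℕ) → List (Vec ℕ m)
allVec zero = [] ∷ []
allVec (suc m) = concatMap (λ x → map (x ∷_) (allVec m)) (1 ∷ 2 ∷ 3 ∷ [])

numSSYT : ∀ {a b} → b ≤ a → ℕ → ℕ
numSSYT {a} {b} b≤a n =
  length (filter (isSSYT? b≤a n) (cartesianProduct (allVec a) (allVec b)))

K : (j n : ℕ) → ℕ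
K j n with j ≤? 3 * n ∸ j
... | yes p = numSSYT p n
... | no _  = 0

ceil2j/3 : ℕ → ℕ
ceil2j/3 j = (2 * j + 2) / 3

floorj/3 : ℕ → ℕ
floorj/3 j = j / 3

{-# OPTIONS --safe #-}
module Submission where

-- Columns strictly increase, so the n 1s of a two-row tableau of content (n, n, n) open its first
-- row, and both rows are then determined by the number c of 2s in the second row; such a tableau
-- exists iff c satisfies four linear inequalities. Hence K_n counts the integers of an interval:
-- [0, j] for n ≥ j, [j - n, 2n - j] for 2j ≤ 3n ≤ 3j, and none for 3n < 2j, where the shape is
-- not a partition. For j = 3q + r with r < 3, ⌈2j/3⌉ = 2q + r and the interval is [q, q + r];
-- its left end q = ⌊j/3⌋ is the tableau with fewest 2s in its second row.

open import Defs
open import Data.Nat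
open import Data.Nat.Properties
open import Data.Nat.DivMod using (_%_; _/_; m≡m%n+[m/n]*n; m%n<n; m*n/n≡m; +-distrib-/-∣ʳ)
open import Data.Nat.Divisibility using (divides)
open import Data.Nat.Tactic.RingSolver using (solve; solve-∀)
open import Data.Bool using (true; false; T)
open import Data.Unit using (tt)
open import Data.Empty using (⊥-elim)
open import Data.Fin using (Fin; toℕ; inject≤; fromℕ<) renaming (zero to fzero; suc to fsuc)
open import Data.Fin.Properties using (toℕ-inject≤; toℕ-fromℕ<; toℕ<n)
open import Data.Vec using (Vec; lookup; tabulate)
open import Data.Vec.Properties using (lookup∘tabulate; ∷-injectiveˡ; ∷-injectiveʳ)
open import Data.List using (List; length; filter; cartesianProduct; applyUpTo)
open import Data.List.Properties using (length-applyUpTo)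
open import Data.List.Membership.Propositional using (_∈_)
open import Data.List.Membership.Propositional.Properties
  using (∈-cartesianProductWith⁺; ∈-cartesianProduct⁺; ∈-filter⁺; ∈-filter⁻; ∈-applyUpTo⁺; ∈-applyUpTo⁻)
open import Data.List.Membership.Propositional.Properties.WithK using (unique∧set⇒bag)
open import Data.List.Relation.Unary.Any using (here; there)
import Data.List.Relation.Unary.All as All
import Data.List.Relation.Unary.AllPairs as AllPairs
open import Data.List.Relation.Unary.Unique.Propositional using (Unique)
open import Data.List.Relation.Unary.Unique.Propositional.Properties
  using (cartesianProductWith⁺; cartesianProduct⁺; filter⁺; applyUpTo⁺₁)
open import Data.List.Relation.Binary.BagAndSetEquality using (_∼[_]_; set; ∼bag⇒↭)
open import Data.List.Relation.Binary.Permutation.Propositional.Properties using (↭-length)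
open import Data.Product using (_×_; _,_; proj₁; proj₂)
open import Function using (_∘_)
open import Function.Bundles using (mk⇔)
open import Relation.Nullary using (¬_; yes; no)
open import Relation.Binary.PropositionalEquality


module TwoRowTableaux where

  open import Data.Vec using ([]; _∷_)
  open import Data.List using ([]; _∷_)

  Entries123 : ∀ {m} → Vec ℕ m → Set
  Entries123 {m} v = (i : Fin m) → (1 ≤ lookup v i) × (lookup v i ≤ 3)

  occ-≢ : ∀ {m} v x (xs : Vec ℕ m) → x ≢ v → occ v (x ∷ xs) ≡ occ v xs
  occ-≢ v x xs x≢v with x ≡ᵇ v in eq
  ... | true  = ⊥-elim (x≢v (≡ᵇ⇒≡ x v (subst T (sym eq) tt)))
  ... | false = refl

  occ-below : ∀ {m} v (xs : Vec ℕ m) → (∀ i → v < lookup xs i) → occ v xs ≡ 0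
  occ-below v []       v<xs = refl
  occ-below v (x ∷ xs) v<xs = trans (occ-≢ v x xs (λ { refl → <-irrefl refl (v<xs fzero) }))
                                    (occ-below v xs (λ i → v<xs (fsuc i)))

  occ-1+2+3 : ∀ {m} (v : Vec ℕ m) → Entries123 v → occ 1 v + occ 2 v + occ 3 v ≡ m
  occ-1+2+3 [] e = refl
  occ-1+2+3 (x ∷ v) e with e fzero | occ-1+2+3 v (λ i → e (fsuc i))
  ... | 1≤x , x≤3 | ih with x
  ... | 1 = cong suc ih
  ... | 2 = trans (cong (_+ occ 3 v) (+-suc (occ 1 v) (occ 2 v))) (cong suc ih)
  ... | 3 = trans (+-suc (occ 1 v + occ 2 v) (occ 3 v)) (cong suc ih)
  ... | 0 = ⊥-elim (1+n≰n 1≤x)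
  ... | suc (suc (suc (suc _))) = ⊥-elim (1+n≰n (≤-trans (s≤s (s≤s (s≤s (s≤s z≤n)))) x≤3))

  sortedEntry : (ones twos i : ℕ) → ℕ
  sortedEntry (suc p) r       zero    = 1
  sortedEntry (suc p) r       (suc i) = sortedEntry p r i
  sortedEntry zero    (suc r) zero    = 2
  sortedEntry zero    (suc r) (suc i) = sortedEntry zero r i
  sortedEntry zero    zero    i       = 3

  sortedRow : (m ones twos : ℕ) → Vec ℕ m
  sortedRow m p r = tabulate (λ i → sortedEntry p r (toℕ i))

  lookup-sortedRow : ∀ m p r (i : Fin m) → lookup (sortedRow m p r) i ≡ sortedEntry p r (toℕ i)
  lookup-sortedRow m p r = lookup∘tabulate (λ i → sortedEntry p r (toℕ i))

  sortedEntry-≥1 : ∀ p r i → 1 ≤ sortedEntry p r i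
  sortedEntry-≥1 (suc p) r       zero    = s≤s z≤n
  sortedEntry-≥1 (suc p) r       (suc i) = sortedEntry-≥1 p r i
  sortedEntry-≥1 zero    (suc r) zero    = s≤s z≤n
  sortedEntry-≥1 zero    (suc r) (suc i) = sortedEntry-≥1 zero r i
  sortedEntry-≥1 zero    zero    i       = s≤s z≤n

  sortedEntry-≤3 : ∀ p r i → sortedEntry p r i ≤ 3
  sortedEntry-≤3 (suc p) r       zero    = s≤s z≤n
  sortedEntry-≤3 (suc p) r       (suc i) = sortedEntry-≤3 p r i
  sortedEntry-≤3 zero    (suc r) zero    = s≤s (s≤s z≤n)
  sortedEntry-≤3 zero    (suc r) (suc i) = sortedEntry-≤3 zero r i
  sortedEntry-≤3 zero    zero    i       = ≤-refl

  sortedEntry-≥2 : ∀ r i → 2 ≤ sortedEntry zero r i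
  sortedEntry-≥2 (suc r) zero    = ≤-refl
  sortedEntry-≥2 (suc r) (suc i) = sortedEntry-≥2 r i
  sortedEntry-≥2 zero    i       = s≤s (s≤s z≤n)

  sortedEntry-mono : ∀ p r {i k} → i ≤ k → sortedEntry p r i ≤ sortedEntry p r k
  sortedEntry-mono (suc p) r       {zero}  {k}     _         = sortedEntry-≥1 (suc p) r k
  sortedEntry-mono (suc p) r       {suc i} {suc k} (s≤s i≤k) = sortedEntry-mono p r i≤k
  sortedEntry-mono zero    (suc r) {zero}  {k}     _         = sortedEntry-≥2 (suc r) k
  sortedEntry-mono zero    (suc r) {suc i} {suc k} (s≤s i≤k) = sortedEntry-mono zero r i≤k
  sortedEntry-mono zero    zero    _                         = ≤-refl

  sortedEntry-ones : ∀ p r {i} → i < p → sortedEntry p r i ≡ 1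
  sortedEntry-ones (suc p) r {zero}  _         = refl
  sortedEntry-ones (suc p) r {suc i} (s≤s i<p) = sortedEntry-ones p r i<p

  sortedEntry-twos : ∀ r {i} → i < r → sortedEntry zero r i ≡ 2
  sortedEntry-twos (suc r) {zero}  _         = refl
  sortedEntry-twos (suc r) {suc i} (s≤s i<r) = sortedEntry-twos r i<r

  sortedEntry-threes : ∀ r {i} → r ≤ i → sortedEntry zero r i ≡ 3
  sortedEntry-threes zero    _         = refl
  sortedEntry-threes (suc r) (s≤s r≤i) = sortedEntry-threes r r≤i

  sortedEntry-≤2 : ∀ p r {i} → i < p + r → sortedEntry p r i ≤ 2
  sortedEntry-≤2 (suc p) r       {zero}  _          = s≤s z≤n
  sortedEntry-≤2 (suc p) r       {suc i} (s≤s i<pr) = sortedEntry-≤2 p r i<pr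
  sortedEntry-≤2 zero    (suc r) {zero}  _          = ≤-refl
  sortedEntry-≤2 zero    (suc r) {suc i} (s≤s i<r)  = sortedEntry-≤2 zero r i<r

  sortedEntry-<3⇒ : ∀ p r {i} → sortedEntry p r i < 3 → i < p + r
  sortedEntry-<3⇒ (suc p) r       {zero}  _ = s≤s z≤n
  sortedEntry-<3⇒ (suc p) r       {suc i} e<3 = s≤s (sortedEntry-<3⇒ p r e<3)
  sortedEntry-<3⇒ zero    (suc r) {zero}  _ = s≤s z≤n
  sortedEntry-<3⇒ zero    (suc r) {suc i} e<3 = s≤s (sortedEntry-<3⇒ zero r e<3)
  sortedEntry-<3⇒ zero    zero    e<3 = ⊥-elim (<-irrefl refl e<3)

  sortedRow-entries123 : ∀ m p r → Entries123 (sortedRow m p r)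
  sortedRow-entries123 m p r i rewrite lookup-sortedRow m p r i =
    sortedEntry-≥1 p r (toℕ i) , sortedEntry-≤3 p r (toℕ i)

  sortedRow-increasing : ∀ m p r → WeaklyIncreasing (sortedRow m p r)
  sortedRow-increasing m p r i k i≤k rewrite lookup-sortedRow m p r i | lookup-sortedRow m p r k =
    sortedEntry-mono p r i≤k

  occ1-sortedRow : ∀ m p r → p ≤ m → occ 1 (sortedRow m p r) ≡ p
  occ1-sortedRow zero    zero    r       _         = refl
  occ1-sortedRow (suc m) (suc p) r       (s≤s p≤m) = cong suc (occ1-sortedRow m p r p≤m)
  occ1-sortedRow (suc m) zero    (suc r) _         = occ1-sortedRow m zero r z≤n
  occ1-sortedRow (suc m) zero    zero    _         = occ1-sortedRow m zero zero z≤n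

  occ2-sortedRow : ∀ m p r → p + r ≤ m → occ 2 (sortedRow m p r) ≡ r
  occ2-sortedRow zero    zero    zero    _          = refl
  occ2-sortedRow (suc m) (suc p) r       (s≤s pr≤m) = occ2-sortedRow m p r pr≤m
  occ2-sortedRow (suc m) zero    (suc r) (s≤s r≤m)  = cong suc (occ2-sortedRow m zero r r≤m)
  occ2-sortedRow (suc m) zero    zero    _          = occ2-sortedRow m zero zero z≤n

  increasing-tail : ∀ {m} x (v : Vec ℕ m) → WeaklyIncreasing (x ∷ v) → WeaklyIncreasing v
  increasing-tail x v inc i k i≤k = inc (fsuc i) (fsuc k) (s≤s i≤k)

  increasing-head : ∀ {m} x (v : Vec ℕ m) → WeaklyIncreasing (x ∷ v) → ∀ i → x ≤ lookup v i
  increasing-head x v inc i = inc fzero (fsuc i) z≤n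

  ≡sortedRow : ∀ {m} (v : Vec ℕ m) → Entries123 v → WeaklyIncreasing v →
               v ≡ sortedRow m (occ 1 v) (occ 2 v)
  ≡sortedRow [] e inc = refl
  ≡sortedRow {suc m} (x ∷ v) e inc with e fzero | ≡sortedRow v (λ i → e (fsuc i)) (increasing-tail x v inc)
  ... | 1≤x , x≤3 | ih with x | increasing-head x v inc
  ... | 1 | _ = cong (1 ∷_) ih
  ... | 2 | 2≤v rewrite occ-below 1 v 2≤v = cong (2 ∷_) ih
  ... | 3 | 3≤v rewrite occ-below 1 v (λ i → <-trans (s≤s (s≤s z≤n)) (3≤v i)) | occ-below 2 v 3≤v =
    cong (3 ∷_) ih
  ... | 0 | _ = ⊥-elim (1+n≰n 1≤x)
  ... | suc (suc (suc (suc _))) | _ = ⊥-elim (1+n≰n (≤-trans (s≤s (s≤s (s≤s (s≤s z≤n)))) x≤3))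

  -- The 2s of the second row sit under 1s, its b - c 3s are at most n, and they sit under
  -- entries below 3, of which the first row has n + (n - c).
  record Admissible (b n c : ℕ) : Set where
    constructor admissible
    field
      twos≤length : c ≤ b
      twos≤n      : c ≤ n
      threes≤n    : b ≤ n + c
      columns     : b + c ≤ n + n

  canonical : (a b n c : ℕ) → Filling a b
  canonical a b n c = sortedRow a n (n ∸ c) , sortedRow b 0 c

  twos-canonical : ∀ a b n {c} → c ≤ b → occ 2 (proj₂ (canonical a b n c)) ≡ c
  twos-canonical a b n {c} = occ2-sortedRow b 0 c

  lookup-inject≤-sortedRow : ∀ {a b} (b≤a : b ≤ a) p r (i : Fin b) →
                             lookup (sortedRow a p r) (inject≤ i b≤a) ≡ sortedEntry p r (toℕ i)
  lookup-inject≤-sortedRow {a} b≤a p r i =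
    trans (lookup-sortedRow a p r (inject≤ i b≤a)) (cong (sortedEntry p r) (toℕ-inject≤ i b≤a))

  module _ {a b} (b≤a : b ≤ a) (n : ℕ) (r₁ : Vec ℕ a) (r₂ : Vec ℕ b)
           (ssyt : IsSSYT b≤a n (r₁ , r₂)) where

    private
      e₁ = proj₁ (proj₁ ssyt)
      e₂ = proj₂ (proj₁ ssyt)
      inc₁ = proj₁ (proj₂ ssyt)
      inc₂ = proj₁ (proj₂ (proj₂ ssyt))
      column = proj₁ (proj₂ (proj₂ (proj₂ ssyt)))
      content = proj₂ (proj₂ (proj₂ (proj₂ ssyt)))
      c = occ 2 r₂
      q₁ = occ 2 r₁

      no1sInRow₂ : occ 1 r₂ ≡ 0
      no1sInRow₂ = occ-below 1 r₂ (λ i → ≤-trans (s≤s (proj₁ (e₁ (inject≤ i b≤a)))) (column i))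

      1sInRow₁ : occ 1 r₁ ≡ n
      1sInRow₁ = trans (sym (+-identityʳ _)) (trans (cong (occ 1 r₁ +_) (sym no1sInRow₂)) (proj₁ content))

      twos : q₁ + c ≡ n
      twos = proj₁ (proj₂ content)

      threes : occ 3 r₁ + occ 3 r₂ ≡ n
      threes = proj₂ (proj₂ content)

      row₂-length : c + occ 3 r₂ ≡ b
      row₂-length = trans (cong (λ z → z + c + occ 3 r₂) (sym no1sInRow₂)) (occ-1+2+3 r₂ e₂)

      row₁≡ : r₁ ≡ sortedRow a n q₁
      row₁≡ = trans (≡sortedRow r₁ e₁ inc₁) (cong (λ p → sortedRow a p q₁) 1sInRow₁)

      -- Otherwise column n + q₁ would have a 3 above an entry of the second row.
      b≤n+q₁ : b ≤ n + q₁
      b≤n+q₁ = ≮⇒≥ λ n+q₁<b →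
        let i = fromℕ< n+q₁<b
            entry≡ = trans (cong (λ r → lookup r (inject≤ i b≤a)) row₁≡)
                           (trans (lookup-inject≤-sortedRow b≤a n q₁ i)
                                  (cong (sortedEntry n q₁) (toℕ-fromℕ< n+q₁<b)))
        in <-irrefl refl (sortedEntry-<3⇒ n q₁
             (subst (_< 3) entry≡ (<-≤-trans (column i) (proj₂ (e₂ i)))))

    ssyt⇒twos+threes : occ 2 r₂ + occ 3 r₂ ≡ b
    ssyt⇒twos+threes = row₂-length

    ssyt⇒≡canonical : (r₁ , r₂) ≡ canonical a b n (occ 2 r₂)
    ssyt⇒≡canonical = cong₂ _,_
      (trans row₁≡ (cong (sortedRow a n) (sym (trans (cong (_∸ c) (sym twos)) (m+n∸n≡m q₁ c)))))
      (trans (≡sortedRow r₂ e₂ inc₂) (cong (λ p → sortedRow b p c) no1sInRow₂))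

    ssyt⇒admissible : Admissible b n (occ 2 r₂)
    ssyt⇒admissible = admissible c≤b c≤n b≤n+c b+c≤n+n
      where
      c≤b : c ≤ b
      c≤b = subst (c ≤_) row₂-length (m≤m+n c (occ 3 r₂))
      c≤n : c ≤ n
      c≤n = subst (c ≤_) twos (m≤n+m c q₁)
      b≤n+c : b ≤ n + c
      b≤n+c = subst (_≤ n + c) (trans (+-comm (occ 3 r₂) c) row₂-length)
                (+-monoˡ-≤ c (subst (occ 3 r₂ ≤_) threes (m≤n+m (occ 3 r₂) (occ 3 r₁))))
      b+c≤n+n : b + c ≤ n + n
      b+c≤n+n = subst (b + c ≤_) (trans (+-assoc n q₁ c) (cong (n +_) twos)) (+-monoˡ-≤ c b≤n+q₁)

  module _ {a b} (b≤a : b ≤ a) (n : ℕ) (a+b≡3n : a + b ≡ 3 * n) {c} (adm : Admissible b n c) where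

    open Admissible adm
    private
      q = n ∸ c
      r₁ = sortedRow a n q
      r₂ = sortedRow b 0 c

      q+c≡n : q + c ≡ n
      q+c≡n = m∸n+n≡m twos≤n

      triple : ∀ n → n + n + n ≡ 3 * n
      triple = solve-∀

      n+q≤a : n + q ≤ a
      n+q≤a = +-cancelʳ-≤ b (n + q) a (begin
        n + q + b        ≤⟨ +-monoʳ-≤ (n + q) threes≤n ⟩
        n + q + (n + c)  ≡⟨ regroup n q c ⟩
        n + n + (q + c)  ≡⟨ cong (n + n +_) q+c≡n ⟩
        n + n + n        ≡⟨ triple n ⟩
        3 * n            ≡⟨ a+b≡3n ⟨
        a + b            ∎)
        where
        open ≤-Reasoning
        regroup : ∀ n q c → n + q + (n + c) ≡ n + n + (q + c)
        regroup = solve-∀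

      b≤n+q : b ≤ n + q
      b≤n+q = +-cancelʳ-≤ c b (n + q)
                (subst (b + c ≤_) (trans (cong (n +_) (sym q+c≡n)) (sym (+-assoc n q c))) columns)

      columnStrict : ColumnStrict b≤a (r₁ , r₂)
      columnStrict i = subst₂ _<_ (sym (lookup-inject≤-sortedRow b≤a n q i)) (sym (lookup-sortedRow b 0 c i))
                         (column (toℕ i) (toℕ<n i))
        where
        column : ∀ x → x < b → sortedEntry n q x < sortedEntry 0 c x
        column x x<b with x <? c
        ... | yes x<c = subst₂ _<_ (sym (sortedEntry-ones n q (<-≤-trans x<c twos≤n)))
                                   (sym (sortedEntry-twos c x<c)) ≤-refl
        ... | no  x≮c = subst (sortedEntry n q x <_) (sym (sortedEntry-threes c (≮⇒≥ x≮c)))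
                              (s≤s (sortedEntry-≤2 n q (<-≤-trans x<b b≤n+q)))

      1s₁ : occ 1 r₁ ≡ n
      1s₁ = occ1-sortedRow a n q (≤-trans (m≤m+n n q) n+q≤a)
      1s₂ : occ 1 r₂ ≡ 0
      1s₂ = occ1-sortedRow b 0 c z≤n
      2s₁ : occ 2 r₁ ≡ q
      2s₁ = occ2-sortedRow a n q n+q≤a
      2s₂ : occ 2 r₂ ≡ c
      2s₂ = occ2-sortedRow b 0 c twos≤length

      3s : occ 3 r₁ + occ 3 r₂ ≡ n
      3s = +-cancelˡ-≡ (n + n) (t₁ + t₂) n (begin
        n + n + (t₁ + t₂)               ≡⟨ cong (λ z → n + z + (t₁ + t₂)) q+c≡n ⟨
        n + (q + c) + (t₁ + t₂)         ≡⟨ regroup n q t₁ c t₂ ⟩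
        (n + q + t₁) + (0 + c + t₂)     ≡⟨ cong₂ _+_ row₁-length row₂-length ⟩
        a + b                           ≡⟨ a+b≡3n ⟩
        3 * n                           ≡⟨ triple n ⟨
        n + n + n                       ∎)
        where
        open ≡-Reasoning
        t₁ = occ 3 r₁
        t₂ = occ 3 r₂
        regroup : ∀ n q t₁ c t₂ → n + (q + c) + (t₁ + t₂) ≡ (n + q + t₁) + (0 + c + t₂)
        regroup = solve-∀
        row₁-length : n + q + t₁ ≡ a
        row₁-length = trans (cong₂ (λ u v → u + v + t₁) (sym 1s₁) (sym 2s₁))
                            (occ-1+2+3 r₁ (sortedRow-entries123 a n q))
        row₂-length : 0 + c + t₂ ≡ b
        row₂-length = trans (cong₂ (λ u v → u + v + t₂) (sym 1s₂) (sym 2s₂))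
                            (occ-1+2+3 r₂ (sortedRow-entries123 b 0 c))

    canonical-isSSYT : IsSSYT b≤a n (canonical a b n c)
    canonical-isSSYT =
      (sortedRow-entries123 a n q , sortedRow-entries123 b 0 c) ,
      sortedRow-increasing a n q , sortedRow-increasing b 0 c , columnStrict ,
      trans (cong₂ _+_ 1s₁ 1s₂) (+-identityʳ n) , trans (cong₂ _+_ 2s₁ 2s₂) q+c≡n , 3s

  fewest-twos : ∀ {a b} (b≤a : b ≤ a) n → a + b ≡ 3 * n → ∀ {c₀} → Admissible b n c₀ → n + c₀ ≡ b →
                (r₁ : Vec ℕ a) (r₂ : Vec ℕ b) → IsSSYT b≤a n (r₁ , r₂) →
                (∀ T′ → IsSSYT b≤a n T′ → occ 2 r₂ ≤ occ 2 (proj₂ T′)) →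
                (occ 2 r₂ ≡ c₀) × (occ 3 r₂ ≡ n)
  fewest-twos {a} {b} b≤a n a+b≡3n {c₀} adm n+c₀≡b r₁ r₂ ssyt minimal = c≡c₀ , t≡n
    where
    c≤c₀ : occ 2 r₂ ≤ c₀
    c≤c₀ = subst (occ 2 r₂ ≤_) (twos-canonical a b n (Admissible.twos≤length adm))
             (minimal (canonical a b n c₀) (canonical-isSSYT b≤a n a+b≡3n adm))
    c₀≤c : c₀ ≤ occ 2 r₂
    c₀≤c = +-cancelˡ-≤ n c₀ (occ 2 r₂)
             (subst (_≤ n + occ 2 r₂) (sym n+c₀≡b) (Admissible.threes≤n (ssyt⇒admissible b≤a n r₁ r₂ ssyt)))
    c≡c₀ : occ 2 r₂ ≡ c₀
    c≡c₀ = ≤-antisym c≤c₀ c₀≤c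
    t≡n : occ 3 r₂ ≡ n
    t≡n = +-cancelˡ-≡ c₀ (occ 3 r₂) n (begin
      c₀ + occ 3 r₂        ≡⟨ cong (_+ occ 3 r₂) c≡c₀ ⟨
      occ 2 r₂ + occ 3 r₂  ≡⟨ ssyt⇒twos+threes b≤a n r₁ r₂ ssyt ⟩
      b                    ≡⟨ n+c₀≡b ⟨
      n + c₀               ≡⟨ +-comm n c₀ ⟩
      c₀ + n               ∎)
      where open ≡-Reasoning

  unique-set⇒length : ∀ {A : Set} {xs ys : List A} → Unique xs → Unique ys → xs ∼[ set ] ys →
                      length xs ≡ length ys
  unique-set⇒length u u′ xs≈ys = ↭-length (∼bag⇒↭ (unique∧set⇒bag u u′ xs≈ys))

  allVec-unique : ∀ m → Unique (allVec m)
  allVec-unique zero    = All.[] AllPairs.∷ AllPairs.[]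
  allVec-unique (suc m) =
    cartesianProductWith⁺ _∷_ (λ eq → ∷-injectiveˡ eq , ∷-injectiveʳ eq) 123-unique (allVec-unique m)
    where
    123-unique : Unique (1 ∷ 2 ∷ 3 ∷ [])
    123-unique = ((λ ()) All.∷ (λ ()) All.∷ All.[])
            AllPairs.∷ ((λ ()) All.∷ All.[])
            AllPairs.∷ All.[]
            AllPairs.∷ AllPairs.[]

  allVec-complete : ∀ {m} (v : Vec ℕ m) → Entries123 v → v ∈ allVec m
  allVec-complete []      e = here refl
  allVec-complete (x ∷ v) e = ∈-cartesianProductWith⁺ _∷_ (x∈123 x (e fzero)) (allVec-complete v (e ∘ fsuc))
    where
    x∈123 : ∀ x → (1 ≤ x) × (x ≤ 3) → x ∈ 1 ∷ 2 ∷ 3 ∷ []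
    x∈123 1 _ = here refl
    x∈123 2 _ = there (here refl)
    x∈123 3 _ = there (there (here refl))
    x∈123 0 (() , _)
    x∈123 (suc (suc (suc (suc _)))) (_ , s≤s (s≤s (s≤s ())))

  module _ {a b} (b≤a : b ≤ a) (n : ℕ) (a+b≡3n : a + b ≡ 3 * n) (lo k : ℕ)
           (admissible⇒ : ∀ c → Admissible b n c → lo ≤ c × c < lo + k)
           (⇒admissible : ∀ c → lo ≤ c → c < lo + k → Admissible b n c) where

    private
      tableaux : List (Filling a b)
      tableaux = filter (isSSYT? b≤a n) (cartesianProduct (allVec a) (allVec b))

      canonicalAt : ℕ → Filling a b
      canonicalAt i = canonical a b n (lo + i)

      canonicals : List (Filling a b)
      canonicals = applyUpTo canonicalAt k

      admissibleAt : ∀ {i} → i < k → Admissible b n (lo + i)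
      admissibleAt i<k = ⇒admissible _ (m≤m+n lo _) (+-monoʳ-< lo i<k)

      canonicals-unique : Unique canonicals
      canonicals-unique = applyUpTo⁺₁ canonicalAt k λ {i} {j} i<j j<k eq →
        <-irrefl (+-cancelˡ-≡ lo i j (begin
          lo + i                            ≡⟨ twos-canonical a b n (Admissible.twos≤length (admissibleAt (<-trans i<j j<k))) ⟨
          occ 2 (proj₂ (canonicalAt i))     ≡⟨ cong (occ 2 ∘ proj₂) eq ⟩
          occ 2 (proj₂ (canonicalAt j))     ≡⟨ twos-canonical a b n (Admissible.twos≤length (admissibleAt j<k)) ⟩
          lo + j                            ∎)) i<j
        where open ≡-Reasoning

      tableau⇒canonical : ∀ {T} → T ∈ tableaux → T ∈ canonicals
      tableau⇒canonical {r₁ , r₂} T∈ = subst (_∈ canonicals) canonical≡T (∈-applyUpTo⁺ canonicalAt i<k)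
        where
        ssyt : IsSSYT b≤a n (r₁ , r₂)
        ssyt = proj₂ (∈-filter⁻ (isSSYT? b≤a n) {xs = cartesianProduct (allVec a) (allVec b)} T∈)
        c = occ 2 r₂
        bounds = admissible⇒ c (ssyt⇒admissible b≤a n r₁ r₂ ssyt)
        lo+i≡c : lo + (c ∸ lo) ≡ c
        lo+i≡c = m+[n∸m]≡n (proj₁ bounds)
        i<k : c ∸ lo < k
        i<k = +-cancelˡ-< lo (c ∸ lo) k (subst (_< lo + k) (sym lo+i≡c) (proj₂ bounds))
        canonical≡T : canonicalAt (c ∸ lo) ≡ (r₁ , r₂)
        canonical≡T = trans (cong (canonical a b n) lo+i≡c) (sym (ssyt⇒≡canonical b≤a n r₁ r₂ ssyt))

      canonical⇒tableau : ∀ {T} → T ∈ canonicals → T ∈ tableaux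
      canonical⇒tableau T∈ with ∈-applyUpTo⁻ canonicalAt T∈
      ... | i , i<k , refl =
        ∈-filter⁺ (isSSYT? b≤a n) (∈-cartesianProduct⁺ (allVec-complete _ entries₁) (allVec-complete _ entries₂)) ssyt
        where
        ssyt = canonical-isSSYT b≤a n a+b≡3n (admissibleAt i<k)
        entries₁ = proj₁ (proj₁ ssyt)
        entries₂ = proj₂ (proj₁ ssyt)

    numSSYT-interval : numSSYT b≤a n ≡ k
    numSSYT-interval = begin
      length tableaux    ≡⟨ unique-set⇒length tableaux-unique canonicals-unique (mk⇔ tableau⇒canonical canonical⇒tableau) ⟩
      length canonicals  ≡⟨ length-applyUpTo canonicalAt k ⟩
      k                  ∎
      where
      open ≡-Reasoning
      tableaux-unique : Unique tableaux
      tableaux-unique = filter⁺ (isSSYT? b≤a n) (cartesianProduct⁺ (allVec-unique a) (allVec-unique b))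

-- Kept apart from the tableau development: with vector and list constructors both in scope,
-- the variable lists passed to the ring solver's solve macro become very slow to elaborate.
open TwoRowTableaux
open import Data.List using ([]; _∷_)

K-yes : ∀ j n (p : j ≤ 3 * n ∸ j) → K j n ≡ numSSYT p n
K-yes j n p with j ≤? 3 * n ∸ j
... | yes p′ = cong (λ q → numSSYT q n) (≤-irrelevant p′ p)
... | no ¬p  = ⊥-elim (¬p p)

K-no : ∀ j n → ¬ (j ≤ 3 * n ∸ j) → K j n ≡ 0
K-no j n ¬p with j ≤? 3 * n ∸ j
... | yes p = ⊥-elim (¬p p)
... | no _  = refl

≤∸⇒+≤ : ∀ j o → j ≤ o ∸ j → j + j ≤ o
≤∸⇒+≤ j o j≤o∸j = m≤o∸n⇒m+n≤o j (≤-trans j≤o∸j (m∸n≤m o j)) j≤o∸j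

K-small : ∀ j n → 3 * n < j + j → K j n ≡ 0
K-small j n 3n<2j = K-no j n (λ p → <⇒≱ 3n<2j (≤∸⇒+≤ j (3 * n) p))

K-interval : ∀ j n → j + j ≤ 3 * n → (lo k : ℕ) →
             (∀ c → Admissible j n c → lo ≤ c × c < lo + k) →
             (∀ c → lo ≤ c → c < lo + k → Admissible j n c) → K j n ≡ k
K-interval j n 2j≤3n lo k admissible⇒ ⇒admissible =
  trans (K-yes j n p) (numSSYT-interval p n (m∸n+n≡m (≤-trans (m≤m+n j j) 2j≤3n)) lo k admissible⇒ ⇒admissible)
  where p = m+n≤o⇒m≤o∸n j 2j≤3n

K-large : ∀ j n → j ≤ n → K j n ≡ suc j
K-large j n j≤n = K-interval j n 2j≤3n 0 (suc j) admissible⇒ ⇒admissible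
  where
  2j≤3n : j + j ≤ 3 * n
  2j≤3n = +-mono-≤ j≤n (≤-trans j≤n (m≤m+n n (n + 0)))
  admissible⇒ : ∀ c → Admissible j n c → 0 ≤ c × c < suc j
  admissible⇒ c adm = z≤n , s≤s (Admissible.twos≤length adm)
  ⇒admissible : ∀ c → 0 ≤ c → c < suc j → Admissible j n c
  ⇒admissible c _ (s≤s c≤j) =
    admissible c≤j (≤-trans c≤j j≤n) (≤-trans j≤n (m≤m+n n c)) (+-mono-≤ j≤n (≤-trans c≤j j≤n))

-- With j = 3d + e and n = 2d + e the admissible interval [j - n, 2n - j] is [d, d + e].
K-3d+e-2d+e : ∀ d e → K (d + d + d + e) (d + d + e) ≡ suc e
K-3d+e-2d+e d e = K-interval (d + d + d + e) (d + d + e) 2j≤3n d (suc e) admissible⇒ ⇒admissible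
  where
  open ≤-Reasoning
  2j≤3n : (d + d + d + e) + (d + d + d + e) ≤ 3 * (d + d + e)
  2j≤3n = begin
    (d + d + d + e) + (d + d + d + e)      ≤⟨ m≤m+n _ e ⟩
    (d + d + d + e) + (d + d + d + e) + e  ≡⟨ solve (d ∷ e ∷ []) ⟩
    3 * (d + d + e)                        ∎
  admissible⇒ : ∀ c → Admissible (d + d + d + e) (d + d + e) c → d ≤ c × c < d + suc e
  admissible⇒ c (admissible _ _ j≤n+c j+c≤n+n) = d≤c , c<d+1+e
    where
    d≤c : d ≤ c
    d≤c = +-cancelˡ-≤ (d + d + e) d c (begin
      (d + d + e) + d  ≡⟨ solve (d ∷ e ∷ []) ⟩
      d + d + d + e    ≤⟨ j≤n+c ⟩
      d + d + e + c    ∎)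
    c≤d+e : c ≤ d + e
    c≤d+e = +-cancelˡ-≤ (d + d + d + e) c (d + e) (begin
      d + d + d + e + c            ≤⟨ j+c≤n+n ⟩
      (d + d + e) + (d + d + e)    ≡⟨ solve (d ∷ e ∷ []) ⟩
      d + d + d + e + (d + e)      ∎)
    c<d+1+e : c < d + suc e
    c<d+1+e = begin-strict
      c            <⟨ s≤s c≤d+e ⟩
      suc (d + e)  ≡⟨ +-suc d e ⟨
      d + suc e    ∎
  ⇒admissible : ∀ c → d ≤ c → c < d + suc e → Admissible (d + d + d + e) (d + d + e) c
  ⇒admissible c d≤c c<d+1+e = admissible c≤j c≤n j≤n+c j+c≤n+n
    where
    c≤d+e : c ≤ d + e
    c≤d+e = s≤s⁻¹ (subst (c <_) (+-suc d e) c<d+1+e)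
    c≤n : c ≤ d + d + e
    c≤n = begin
      c            ≤⟨ c≤d+e ⟩
      d + e        ≤⟨ m≤n+m (d + e) d ⟩
      d + (d + e)  ≡⟨ solve (d ∷ e ∷ []) ⟩
      d + d + e    ∎
    c≤j : c ≤ d + d + d + e
    c≤j = begin
      c                  ≤⟨ c≤n ⟩
      d + d + e          ≤⟨ m≤n+m _ d ⟩
      d + (d + d + e)    ≡⟨ solve (d ∷ e ∷ []) ⟩
      d + d + d + e      ∎
    j≤n+c : d + d + d + e ≤ d + d + e + c
    j≤n+c = begin
      d + d + d + e    ≡⟨ solve (d ∷ e ∷ []) ⟩
      d + d + e + d    ≤⟨ +-monoʳ-≤ (d + d + e) d≤c ⟩
      d + d + e + c    ∎
    j+c≤n+n : d + d + d + e + c ≤ (d + d + e) + (d + d + e)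
    j+c≤n+n = begin
      d + d + d + e + c          ≤⟨ +-monoʳ-≤ (d + d + d + e) c≤d+e ⟩
      d + d + d + e + (d + e)    ≡⟨ solve (d ∷ e ∷ []) ⟩
      (d + d + e) + (d + d + e)  ∎

K-middle : ∀ j n → n ≤ j → j + j ≤ 3 * n → K j n ≡ suc (3 * n ∸ (j + j))
K-middle j n n≤j 2j≤3n = reparametrise (j ∸ n) (3 * n ∸ (j + j)) (m∸n+n≡m n≤j) (m+[n∸m]≡n 2j≤3n)
  where
  open ≡-Reasoning
  reparametrise : ∀ d e → d + n ≡ j → j + j + e ≡ 3 * n → K j n ≡ suc e
  reparametrise d e d+n≡j 2j+e≡3n = subst₂ (λ x y → K x y ≡ suc e) (sym j≡) (sym n≡) (K-3d+e-2d+e d e)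
    where
    n≡ : n ≡ d + d + e
    n≡ = +-cancelʳ-≡ (n + n) n (d + d + e) (begin
      n + (n + n)              ≡⟨ solve (n ∷ []) ⟩
      3 * n                    ≡⟨ 2j+e≡3n ⟨
      j + j + e                ≡⟨ cong (λ x → x + x + e) d+n≡j ⟨
      (d + n) + (d + n) + e    ≡⟨ solve (d ∷ n ∷ e ∷ []) ⟩
      d + d + e + (n + n)      ∎)
    j≡ : j ≡ d + d + d + e
    j≡ = begin
      j                ≡⟨ d+n≡j ⟨
      d + n            ≡⟨ cong (d +_) n≡ ⟩
      d + (d + d + e)  ≡⟨ solve (d ∷ e ∷ []) ⟩
      d + d + d + e    ∎

j≡3⌊j/3⌋+j%3 : ∀ j → j ≡ floorj/3 j + floorj/3 j + floorj/3 j + j % 3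
j≡3⌊j/3⌋+j%3 j = trans (m≡m%n+[m/n]*n j 3) (rearrange (j % 3) (j / 3))
  where
  rearrange : ∀ r q → r + q * 3 ≡ q + q + q + r
  rearrange = solve-∀

⌈2j/3⌉≡2⌊j/3⌋+j%3 : ∀ j → ceil2j/3 j ≡ floorj/3 j + floorj/3 j + j % 3
⌈2j/3⌉≡2⌊j/3⌋+j%3 j = begin
  (2 * j + 2) / 3                  ≡⟨ cong (λ x → (2 * x + 2) / 3) (j≡3⌊j/3⌋+j%3 j) ⟩
  (2 * (q + q + q + r) + 2) / 3    ≡⟨ cong (_/ 3) (rearrange q r) ⟩
  (2 * r + 2 + (q + q) * 3) / 3    ≡⟨ +-distrib-/-∣ʳ (2 * r + 2) (divides (q + q) refl) ⟩
  (2 * r + 2) / 3 + (q + q) * 3 / 3 ≡⟨ cong₂ _+_ (round r (m%n<n j 3)) (m*n/n≡m (q + q) 3) ⟩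
  r + (q + q)                      ≡⟨ +-comm r (q + q) ⟩
  q + q + r                        ∎
  where
  open ≡-Reasoning
  q = floorj/3 j
  r = j % 3
  rearrange : ∀ q r → 2 * (q + q + q + r) + 2 ≡ 2 * r + 2 + (q + q) * 3
  rearrange = solve-∀
  round : ∀ r → r < 3 → (2 * r + 2) / 3 ≡ r
  round 0 _ = refl
  round 1 _ = refl
  round 2 _ = refl
  round (suc (suc (suc _))) (s≤s (s≤s (s≤s ())))

3⌈2j/3⌉≡2j+j%3 : ∀ j → 3 * ceil2j/3 j ≡ j + j + j % 3
3⌈2j/3⌉≡2j+j%3 j = begin
  3 * ceil2j/3 j                            ≡⟨ cong (3 *_) (⌈2j/3⌉≡2⌊j/3⌋+j%3 j) ⟩
  3 * (q + q + r)                           ≡⟨ rearrange q r ⟩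
  (q + q + q + r) + (q + q + q + r) + r     ≡⟨ cong (λ x → x + x + r) (j≡3⌊j/3⌋+j%3 j) ⟨
  j + j + r                                 ∎
  where
  open ≡-Reasoning
  q = floorj/3 j
  r = j % 3
  rearrange : ∀ q r → 3 * (q + q + r) ≡ (q + q + q + r) + (q + q + q + r) + r
  rearrange = solve-∀

⌈2j/3⌉+⌊j/3⌋≡j : ∀ j → ceil2j/3 j + floorj/3 j ≡ j
⌈2j/3⌉+⌊j/3⌋≡j j = begin
  ceil2j/3 j + q       ≡⟨ cong (_+ q) (⌈2j/3⌉≡2⌊j/3⌋+j%3 j) ⟩
  q + q + r + q        ≡⟨ rearrange q r ⟩
  q + q + q + r        ≡⟨ j≡3⌊j/3⌋+j%3 j ⟨
  j                    ∎
  where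
  open ≡-Reasoning
  q = floorj/3 j
  r = j % 3
  rearrange : ∀ q r → q + q + r + q ≡ q + q + q + r
  rearrange = solve-∀

2⌊j/3⌋≤⌈2j/3⌉ : ∀ j → floorj/3 j + floorj/3 j ≤ ceil2j/3 j
2⌊j/3⌋≤⌈2j/3⌉ j = subst (floorj/3 j + floorj/3 j ≤_) (sym (⌈2j/3⌉≡2⌊j/3⌋+j%3 j)) (m≤m+n _ (j % 3))

⌈2j/3⌉≤j : ∀ j → ceil2j/3 j ≤ j
⌈2j/3⌉≤j j = subst (ceil2j/3 j ≤_) (⌈2j/3⌉+⌊j/3⌋≡j j) (m≤m+n _ _)

2j≤3⌈2j/3⌉ : ∀ j → j + j ≤ 3 * ceil2j/3 j
2j≤3⌈2j/3⌉ j = subst (j + j ≤_) (sym (3⌈2j/3⌉≡2j+j%3 j)) (m≤m+n _ _)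

K-below-⌈2j/3⌉ : ∀ j n → n < ceil2j/3 j → K j n ≡ 0
K-below-⌈2j/3⌉ j n n<n₀ = K-small j n (+-cancelˡ-≤ 2 _ _ (begin
  3 + 3 * n        ≡⟨ *-suc 3 n ⟨
  3 * suc n        ≤⟨ *-monoʳ-≤ 3 n<n₀ ⟩
  3 * ceil2j/3 j   ≡⟨ 3⌈2j/3⌉≡2j+j%3 j ⟩
  j + j + j % 3    ≤⟨ +-monoʳ-≤ (j + j) (s≤s⁻¹ (m%n<n j 3)) ⟩
  j + j + 2        ≡⟨ +-comm (j + j) 2 ⟩
  2 + (j + j)      ∎))
  where open ≤-Reasoning

K-at-⌈2j/3⌉ : ∀ j → K j (ceil2j/3 j) ≡ suc (j % 3)
K-at-⌈2j/3⌉ j = begin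
  K j (ceil2j/3 j)                           ≡⟨ K-middle j _ (⌈2j/3⌉≤j j) (2j≤3⌈2j/3⌉ j) ⟩
  suc (3 * ceil2j/3 j ∸ (j + j))             ≡⟨ cong (λ x → suc (x ∸ (j + j))) (3⌈2j/3⌉≡2j+j%3 j) ⟩
  suc (j + j + j % 3 ∸ (j + j))              ≡⟨ cong suc (m+n∸m≡n (j + j) (j % 3)) ⟩
  suc (j % 3)                                ∎
  where open ≡-Reasoning

K-strictly-increasing : ∀ j m n → ceil2j/3 j ≤ m → m < n → n ≤ j → K j m < K j n
K-strictly-increasing j m n n₀≤m m<n n≤j = begin-strict
  K j m                   ≡⟨ K-middle j m (≤-trans (<⇒≤ m<n) n≤j) 2j≤3m ⟩
  suc (3 * m ∸ (j + j))   <⟨ s≤s (∸-monoˡ-< (*-monoʳ-< 3 m<n) 2j≤3m) ⟩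
  suc (3 * n ∸ (j + j))   ≡⟨ K-middle j n n≤j (≤-trans 2j≤3m (*-monoʳ-≤ 3 (<⇒≤ m<n))) ⟨
  K j n                   ∎
  where
  open ≤-Reasoning
  2j≤3m : j + j ≤ 3 * m
  2j≤3m = ≤-trans (2j≤3⌈2j/3⌉ j) (*-monoʳ-≤ 3 n₀≤m)

admissible-⌊j/3⌋ : ∀ j → Admissible j (ceil2j/3 j) (floorj/3 j)
admissible-⌊j/3⌋ j = admissible q≤j q≤n₀ (≤-reflexive (sym n₀+q≡j)) j+q≤n₀+n₀
  where
  open ≤-Reasoning
  n₀ = ceil2j/3 j
  q = floorj/3 j
  n₀+q≡j = ⌈2j/3⌉+⌊j/3⌋≡j j
  q≤j : q ≤ j
  q≤j = subst (q ≤_) n₀+q≡j (m≤n+m q n₀)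
  q≤n₀ : q ≤ n₀
  q≤n₀ = ≤-trans (m≤m+n q q) (2⌊j/3⌋≤⌈2j/3⌉ j)
  j+q≤n₀+n₀ : j + q ≤ n₀ + n₀
  j+q≤n₀+n₀ = begin
    j + q          ≡⟨ cong (_+ q) n₀+q≡j ⟨
    n₀ + q + q     ≡⟨ +-assoc n₀ q q ⟩
    n₀ + (q + q)   ≤⟨ +-monoʳ-≤ n₀ (2⌊j/3⌋≤⌈2j/3⌉ j) ⟩
    n₀ + n₀        ∎

mainTheorem4 :
    (j : ℕ) →
    ((n : ℕ) → n < ceil2j/3 j → K j n ≡ 0) ×
    (0 < K j (ceil2j/3 j)) ×
    ((m n : ℕ) → ceil2j/3 j ≤ m → m < n → n ≤ j → K j m < K j n) ×
    ((n : ℕ) → j ≤ n → K j n ≡ suc j) ×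
    ((j % 3 ≡ 0 → K j (ceil2j/3 j) ≡ 1) ×
     (j % 3 ≡ 1 → K j (ceil2j/3 j) ≡ 2) ×
     (j % 3 ≡ 2 → K j (ceil2j/3 j) ≡ 3)) ×
    ((p : j ≤ 3 * ceil2j/3 j ∸ j) →
     (T : Filling (3 * ceil2j/3 j ∸ j) j) → IsSSYT p (ceil2j/3 j) T →
     ((T′ : Filling (3 * ceil2j/3 j ∸ j) j) → IsSSYT p (ceil2j/3 j) T′ →
        occ 2 (proj₂ T) ≤ occ 2 (proj₂ T′)) →
     (occ 2 (proj₂ T) ≡ floorj/3 j) × (occ 3 (proj₂ T) ≡ ceil2j/3 j))
mainTheorem4 j =
  K-below-⌈2j/3⌉ j ,
  subst (0 <_) (sym (K-at-⌈2j/3⌉ j)) (s≤s z≤n) ,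
  K-strictly-increasing j ,
  K-large j ,
  (at-residue , at-residue , at-residue) ,
  λ p (r₁ , r₂) → fewest-twos p (ceil2j/3 j) a+j≡3n₀ (admissible-⌊j/3⌋ j) (⌈2j/3⌉+⌊j/3⌋≡j j) r₁ r₂
  where
  at-residue : ∀ {r} → j % 3 ≡ r → K j (ceil2j/3 j) ≡ suc r
  at-residue j%3≡r = trans (K-at-⌈2j/3⌉ j) (cong suc j%3≡r)
  a+j≡3n₀ : 3 * ceil2j/3 j ∸ j + j ≡ 3 * ceil2j/3 j
  a+j≡3n₀ = m∸n+n≡m (≤-trans (m≤m+n j j) (2j≤3⌈2j/3⌉ j))
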